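{- Let $n\ge 1$ and let $s$ be an integer with $n/2<s\le n$. Let $\tilde\gamma_s=(0,\dots,0,1,\dots,1)\in\{0,1\}^n$ be the tuple with $n-s$ zeros followed by $s$ ones. Let $T',T''$ be antichains in $\{0,1\}^n$ (with respect to the componentwise order) such that $\tilde\gamma_s\in T'$ and there are no $\tilde\alpha'\in T'$, $\tilde\alpha''\in T''$ with $\tilde\alpha'\ge\tilde\alpha''$. Then \[ |T'|+|T''|\le 1+\binom{n+1}{\lfloor n/2\rfloor+1}-\binom{s+1}{\lfloor n/2\rfloor+1}. \]
   Context: $\{0,1\}^n$ is partially ordered componentwise: $\tilde\alpha\le\tilde\beta$ iff $\alpha_i\le\beta_i$ for all $i$. An antichain is a set of pairwise incomparable tuples. -}

module Defs where

open import Data.Bool using (Bool; true; false)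
open import Data.Bool.Base using () renaming (_≤_ to _≤ᵇ_)
open import Data.Nat using (ℕ; _∸_; _≤?_)
open import Data.Fin using (Fin; toℕ)
open import Data.Vec using (Vec; tabulate)
open import Data.Vec.Relation.Binary.Pointwise.Inductive using (Pointwise)
open import Data.List using (List)
open import Data.List.Membership.Propositional using (_∈_)
open import Data.List.Relation.Unary.Unique.Propositional using (Unique)
open import Relation.Nullary using (¬_)
open import Relation.Nullary.Decidable using (does)
open import Relation.Binary.PropositionalEquality using (_≡_)
open import Data.Product using (_×_)

-- Boolean cube {0,1}^n, false = 0, true = 1
Cube : ℕ → Set
Cube n = Vec Bool n

_≼_ : ∀ {n} → Cube n → Cube n → Set
α ≼ β = Pointwise _≤ᵇ_ α β

-- an antichain: a finite set (duplicate-free list) of pairwise incomparable tuples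
IsAntichain : ∀ {n} → List (Cube n) → Set
IsAntichain {n} T =
  Unique T × (∀ (α β : Cube n) → α ∈ T → β ∈ T → α ≼ β → α ≡ β)

γ : (n s : ℕ) → Cube n
γ n s = tabulate (λ (i : Fin n) → does ((n ∸ s) ≤? toℕ i))

module Submission where

-- Put k = ⌊n/2⌋ and g = γ n s; call the tuples of weight k or
-- k+1 the middle points of the cube.  The argument is a symmetric chain one.
--  * de Bruijn's recursive construction partitions {0,1}^n into symmetric
--    chains x_i ≺ x_{i+1} ≺ … ≺ x_{n-i} (x_j of weight j).  Such a chain
--    contains min(2, length) middle points, and, for g = γ n s, every chain
--    either lies below g or meets ↓g at most in its first element.
--  * On a chain, T′ ∪ T″ has at most two points besides g (one from each
--    antichain), and these lie outside ↓g.  With the shape of the chain this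
--    gives, for every chain C,
--      |C ∩ T′| + |C ∩ T″| + |C ∩ ↓g ∩ middle| ≤ [g ∈ C] + |C ∩ middle|.
--  * Summing over the chains and counting: the cube has (n+1 C k+1) middle
--    points, and ↓g, a copy of {0,1}^s, has (s+1 C k+1) of them.

open import Defs
open import Data.Nat
  using (ℕ; zero; suc; _+_; _*_; _∸_; _≤_; _<_; _/_; _⊓_; _≡ᵇ_; _<ᵇ_; _≤ᵇ_; z≤n; s≤s; ⌊_/2⌋)
open import Data.Nat.Properties
open import Data.Nat.DivMod using (m/n≡1+[m∸n]/n)
open import Data.Nat.Combinatorics using (_C_; nCk+nC[k+1]≡[n+1]C[k+1])
open import Algebra.Properties.CommutativeSemigroup +-commutativeSemigroup using (interchange)
open import Data.Bool using (Bool; true; false; _∧_; _∨_; not; if_then_else_)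
open import Data.Bool.Base using (f≤t; b≤b)
open import Data.Vec using ([]; _∷_; replicate; tabulate)
open import Data.Vec.Properties using (tabulate-cong)
open import Data.Fin using (toℕ)
open import Data.Vec.Relation.Binary.Pointwise.Inductive using ([]; _∷_)
open import Data.List using (List; []; _∷_; length; map; _++_)
open import Data.List.Properties using (length-map)
open import Data.List.Membership.Propositional using (_∈_)
open import Data.List.Relation.Unary.Any using (here; there)
import Data.List.Relation.Unary.All as All
open All using (All; []; _∷_)
open import Data.List.Relation.Unary.All.Properties using (map⁺)
import Data.List.Relation.Unary.AllPairs as AllPairs
open AllPairs using (AllPairs; []; _∷_)
import Data.List.Relation.Unary.AllPairs.Properties as AllPairsₚ
open import Data.List.Relation.Unary.Unique.Propositional using (Unique)
open import Data.Product using (Σ; _×_; _,_; proj₁; proj₂)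
open import Data.Sum using (_⊎_; inj₁; inj₂)
open import Data.Unit using (⊤; tt)
open import Data.Empty using (⊥; ⊥-elim)
open import Relation.Nullary using (¬_)
open import Relation.Binary.PropositionalEquality

private variable
  A B : Set

∑ : (A → ℕ) → List A → ℕ
∑ f []       = 0
∑ f (x ∷ xs) = f x + ∑ f xs

∑-mono : {f g : A → ℕ} {xs : List A} → All (λ x → f x ≤ g x) xs → ∑ f xs ≤ ∑ g xs
∑-mono []       = z≤n
∑-mono (p ∷ ps) = +-mono-≤ p (∑-mono ps)

∑-cong : {f g : A → ℕ} {xs : List A} → All (λ x → f x ≡ g x) xs → ∑ f xs ≡ ∑ g xs
∑-cong []       = refl
∑-cong (p ∷ ps) = cong₂ _+_ p (∑-cong ps)

∑-+ : (f g : A → ℕ) (xs : List A) → ∑ (λ x → f x + g x) xs ≡ ∑ f xs + ∑ g xs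
∑-+ f g []       = refl
∑-+ f g (x ∷ xs) =
  trans (cong (f x + g x +_) (∑-+ f g xs)) (interchange (f x) (g x) (∑ f xs) (∑ g xs))

∑-++ : (f : A → ℕ) (xs ys : List A) → ∑ f (xs ++ ys) ≡ ∑ f xs + ∑ f ys
∑-++ f []       ys = refl
∑-++ f (x ∷ xs) ys = trans (cong (f x +_) (∑-++ f xs ys)) (sym (+-assoc (f x) (∑ f xs) (∑ f ys)))

∑-map : (f : B → ℕ) (h : A → B) (xs : List A) → ∑ f (map h xs) ≡ ∑ (λ x → f (h x)) xs
∑-map f h []       = refl
∑-map f h (x ∷ xs) = cong (f (h x) +_) (∑-map f h xs)

∑-zero : (xs : List A) → ∑ (λ _ → 0) xs ≡ 0
∑-zero []       = refl
∑-zero (x ∷ xs) = ∑-zero xs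

ι : Bool → ℕ
ι true  = 1
ι false = 0

wt : ∀ {n} → Cube n → ℕ
wt []          = 0
wt (false ∷ x) = wt x
wt (true ∷ x)  = suc (wt x)

cube : (n : ℕ) → List (Cube n)
cube zero    = [] ∷ []
cube (suc n) = map (false ∷_) (cube n) ++ map (true ∷_) (cube n)

∑-cube : ∀ {n} (f : Cube (suc n) → ℕ) →
  ∑ f (cube (suc n)) ≡ ∑ (λ x → f (false ∷ x)) (cube n) + ∑ (λ x → f (true ∷ x)) (cube n)
∑-cube {n} f = begin
  ∑ f (map (false ∷_) (cube n) ++ map (true ∷_) (cube n))
    ≡⟨ ∑-++ f (map (false ∷_) (cube n)) (map (true ∷_) (cube n)) ⟩
  ∑ f (map (false ∷_) (cube n)) + ∑ f (map (true ∷_) (cube n))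
    ≡⟨ cong₂ _+_ (∑-map f (false ∷_) (cube n)) (∑-map f (true ∷_) (cube n)) ⟩
  ∑ (λ x → f (false ∷ x)) (cube n) + ∑ (λ x → f (true ∷ x)) (cube n) ∎
  where open ≡-Reasoning

level : ℕ → ℕ → ℕ
level j w = ι (w ≡ᵇ j)

level-count : ∀ n j → ∑ (λ x → level j (wt x)) (cube n) ≡ n C j
level-count zero    zero    = refl
level-count zero    (suc j) = refl
level-count (suc n) zero    = begin
  ∑ (λ x → level 0 (wt x)) (cube (suc n))  ≡⟨ ∑-cube {n} (λ x → level 0 (wt x)) ⟩
  ∑ (λ x → level 0 (wt x)) (cube n) + ∑ (λ _ → 0) (cube n)
    ≡⟨ cong₂ _+_ (level-count n 0) (∑-zero (cube n)) ⟩
  n C 0 + 0 ∎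
  where open ≡-Reasoning
level-count (suc n) (suc j) = begin
  ∑ (λ x → level (suc j) (wt x)) (cube (suc n))  ≡⟨ ∑-cube {n} (λ x → level (suc j) (wt x)) ⟩
  ∑ (λ x → level (suc j) (wt x)) (cube n) + ∑ (λ x → level j (wt x)) (cube n)
    ≡⟨ cong₂ _+_ (level-count n (suc j)) (level-count n j) ⟩
  n C suc j + n C j                               ≡⟨ +-comm (n C suc j) (n C j) ⟩
  n C j + n C suc j                               ≡⟨ nCk+nC[k+1]≡[n+1]C[k+1] n j ⟩
  suc n C suc j ∎
  where open ≡-Reasoning

middle : ℕ → ℕ → ℕ
middle k w = level k w + level (suc k) w

middle-count : ∀ n k → ∑ (λ x → middle k (wt x)) (cube n) ≡ suc n C suc k
middle-count n k = begin
  ∑ (λ x → middle k (wt x)) (cube n)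
    ≡⟨ ∑-+ (λ x → level k (wt x)) (λ x → level (suc k) (wt x)) (cube n) ⟩
  ∑ (λ x → level k (wt x)) (cube n) + ∑ (λ x → level (suc k) (wt x)) (cube n)
    ≡⟨ cong₂ _+_ (level-count n k) (level-count n (suc k)) ⟩
  n C k + n C suc k
    ≡⟨ nCk+nC[k+1]≡[n+1]C[k+1] n k ⟩
  suc n C suc k ∎
  where open ≡-Reasoning

-- Boolean tests for equality and for the componentwise order on the cube;
-- they compute by recursion on the coordinates, which the counting uses.
_≡ᶜ_ : ∀ {n} → Cube n → Cube n → Bool
[]          ≡ᶜ []          = true
(false ∷ x) ≡ᶜ (false ∷ y) = x ≡ᶜ y
(true ∷ x)  ≡ᶜ (true ∷ y)  = x ≡ᶜ y
(false ∷ x) ≡ᶜ (true ∷ y)  = false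
(true ∷ x)  ≡ᶜ (false ∷ y) = false

_≤ᶜ_ : ∀ {n} → Cube n → Cube n → Bool
[]          ≤ᶜ []          = true
(false ∷ x) ≤ᶜ (_ ∷ y)     = x ≤ᶜ y
(true ∷ x)  ≤ᶜ (true ∷ y)  = x ≤ᶜ y
(true ∷ x)  ≤ᶜ (false ∷ y) = false

≡ᶜ-refl : ∀ {n} (x : Cube n) → (x ≡ᶜ x) ≡ true
≡ᶜ-refl []          = refl
≡ᶜ-refl (false ∷ x) = ≡ᶜ-refl x
≡ᶜ-refl (true ∷ x)  = ≡ᶜ-refl x

≡ᶜ-sound : ∀ {n} (x y : Cube n) → (x ≡ᶜ y) ≡ true → x ≡ y
≡ᶜ-sound []          []          _ = refl
≡ᶜ-sound (false ∷ x) (false ∷ y) p = cong (false ∷_) (≡ᶜ-sound x y p)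
≡ᶜ-sound (true ∷ x)  (true ∷ y)  p = cong (true ∷_) (≡ᶜ-sound x y p)

≤ᶜ-sound : ∀ {n} (x y : Cube n) → (x ≤ᶜ y) ≡ true → x ≼ y
≤ᶜ-sound []          []          _ = []
≤ᶜ-sound (false ∷ x) (false ∷ y) p = b≤b ∷ ≤ᶜ-sound x y p
≤ᶜ-sound (false ∷ x) (true ∷ y)  p = f≤t ∷ ≤ᶜ-sound x y p
≤ᶜ-sound (true ∷ x)  (true ∷ y)  p = b≤b ∷ ≤ᶜ-sound x y p

≼-refl : ∀ {n} (x : Cube n) → x ≼ x
≼-refl []      = []
≼-refl (a ∷ x) = b≤b ∷ ≼-refl x

_∈ᶜ_ : ∀ {n} → Cube n → List (Cube n) → Bool
x ∈ᶜ []       = false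
x ∈ᶜ (y ∷ ys) = (x ≡ᶜ y) ∨ (x ∈ᶜ ys)

∈ᶜ-sound : ∀ {n} (x : Cube n) (T : List (Cube n)) → (x ∈ᶜ T) ≡ true → x ∈ T
∈ᶜ-sound x (y ∷ T) p with x ≡ᶜ y in e
... | true  = here (≡ᶜ-sound x y e)
... | false = there (∈ᶜ-sound x T p)

point-count : ∀ n (g : Cube n) → ∑ (λ x → ι (x ≡ᶜ g)) (cube n) ≡ 1
point-count zero    []          = refl
point-count (suc n) (false ∷ g) = begin
  ∑ (λ x → ι (x ≡ᶜ (false ∷ g))) (cube (suc n))   ≡⟨ ∑-cube {n} (λ x → ι (x ≡ᶜ (false ∷ g))) ⟩
  ∑ (λ x → ι (x ≡ᶜ g)) (cube n) + ∑ (λ _ → 0) (cube n)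
    ≡⟨ cong₂ _+_ (point-count n g) (∑-zero (cube n)) ⟩
  1 ∎
  where open ≡-Reasoning
point-count (suc n) (true ∷ g) = begin
  ∑ (λ x → ι (x ≡ᶜ (true ∷ g))) (cube (suc n))    ≡⟨ ∑-cube {n} (λ x → ι (x ≡ᶜ (true ∷ g))) ⟩
  ∑ (λ _ → 0) (cube n) + ∑ (λ x → ι (x ≡ᶜ g)) (cube n)
    ≡⟨ cong₂ _+_ (∑-zero (cube n)) (point-count n g) ⟩
  1 ∎
  where open ≡-Reasoning

unique-count : ∀ {n} (T : List (Cube n)) → Unique T → length T ≤ ∑ (λ x → ι (x ∈ᶜ T)) (cube n)
unique-count     []      _            = z≤n
unique-count {n} (y ∷ T) (y∉T ∷ uniq) = begin
  1 + length T
    ≤⟨ +-mono-≤ (≤-reflexive (sym (point-count n y))) (unique-count T uniq) ⟩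
  ∑ (λ x → ι (x ≡ᶜ y)) (cube n) + ∑ (λ x → ι (x ∈ᶜ T)) (cube n)
    ≡⟨ sym (∑-+ (λ x → ι (x ≡ᶜ y)) (λ x → ι (x ∈ᶜ T)) (cube n)) ⟩
  ∑ (λ x → ι (x ≡ᶜ y) + ι (x ∈ᶜ T)) (cube n)
    ≤⟨ ∑-mono (All.universal disjoint (cube n)) ⟩
  ∑ (λ x → ι (x ∈ᶜ (y ∷ T))) (cube n) ∎
  where
  open ≤-Reasoning
  disjoint : ∀ x → ι (x ≡ᶜ y) + ι (x ∈ᶜ T) ≤ ι ((x ≡ᶜ y) ∨ (x ∈ᶜ T))
  disjoint x with x ≡ᶜ y in e | x ∈ᶜ T in m
  ... | true  | true  with refl ← ≡ᶜ-sound x y e = ⊥-elim (All.lookup y∉T (∈ᶜ-sound x T m) refl)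
  ... | true  | false = ≤-refl
  ... | false | _     = ≤-refl

γ-suc : ∀ n s → s ≤ n → γ (suc n) s ≡ false ∷ γ n s
γ-suc n s s≤n rewrite +-∸-assoc 1 s≤n =
  cong (false ∷_) (tabulate-cong (λ i → <ᵇ-suc (n ∸ s) (toℕ i)))
  where
  <ᵇ-suc : ∀ a j → (a <ᵇ suc j) ≡ (a ≤ᵇ j)
  <ᵇ-suc zero    j = refl
  <ᵇ-suc (suc a) j = refl

γ-top : ∀ n → γ n n ≡ replicate n true
γ-top n rewrite n∸n≡0 n = all-ones n
  where
  all-ones : ∀ m → tabulate {n = m} (λ _ → true) ≡ replicate m true
  all-ones zero    = refl
  all-ones (suc m) = cong (true ∷_) (all-ones m)

≤ᶜ-top : ∀ {n} (x : Cube n) → (x ≤ᶜ replicate n true) ≡ true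
≤ᶜ-top []          = refl
≤ᶜ-top (false ∷ x) = ≤ᶜ-top x
≤ᶜ-top (true ∷ x)  = ≤ᶜ-top x

-- Summing a function of the weight over the down-set ↓(γ n s) is summing it
-- over {0,1}^s: ↓(γ n s) consists of n-s zeros followed by any s-tuple.
∑-below-γ : ∀ n s → s ≤ n → (f : ℕ → ℕ) →
  ∑ (λ x → if x ≤ᶜ γ n s then f (wt x) else 0) (cube n) ≡ ∑ (λ y → f (wt y)) (cube s)
∑-below-γ zero    _ z≤n f = refl
∑-below-γ (suc n) s s≤ f with m≤n⇒m<n∨m≡n s≤
... | inj₂ refl rewrite γ-top (suc n) =
  ∑-cong (All.universal (λ x → cong (λ b → if b then f (wt x) else 0) (≤ᶜ-top x)) (cube (suc n)))
... | inj₁ (s≤s s≤n) rewrite γ-suc n s s≤n = begin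
  ∑ (λ x → if x ≤ᶜ (false ∷ γ n s) then f (wt x) else 0) (cube (suc n))
    ≡⟨ ∑-cube {n} (λ x → if x ≤ᶜ (false ∷ γ n s) then f (wt x) else 0) ⟩
  ∑ (λ x → if x ≤ᶜ γ n s then f (wt x) else 0) (cube n) + ∑ (λ _ → 0) (cube n)
    ≡⟨ cong₂ _+_ (∑-below-γ n s s≤n f) (∑-zero (cube n)) ⟩
  ∑ (λ y → f (wt y)) (cube s) + 0
    ≡⟨ +-identityʳ _ ⟩
  ∑ (λ y → f (wt y)) (cube s) ∎
  where open ≡-Reasoning

belowMiddle : ∀ {n} → ℕ → Cube n → Cube n → ℕ
belowMiddle k g x = if x ≤ᶜ g then middle k (wt x) else 0

below-middle-count : ∀ n s → s ≤ n → ∀ k → ∑ (belowMiddle k (γ n s)) (cube n) ≡ suc s C suc k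
below-middle-count n s s≤n k = trans (∑-below-γ n s s≤n (middle k)) (middle-count s k)

-- de Bruijn's step: a chain x₁ ≺ x₂ ≺ … ≺ x_m of {0,1}^n yields the two chains
-- 0x₁ ≺ 1x₁ ≺ 1x₂ ≺ … ≺ 1x_m and 0x₂ ≺ … ≺ 0x_m of {0,1}^(n+1).
grow : ∀ {n} → List (Cube n) → List (Cube (suc n))
grow []       = []
grow (x ∷ xs) = (false ∷ x) ∷ map (true ∷_) (x ∷ xs)

shrink : ∀ {n} → List (Cube n) → List (Cube (suc n))
shrink []       = []
shrink (x ∷ xs) = map (false ∷_) xs

splitChains : ∀ {n} → List (List (Cube n)) → List (List (Cube (suc n)))
splitChains []         = []
splitChains (Ch ∷ Chs) = grow Ch ∷ shrink Ch ∷ splitChains Chs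

-- The symmetric chain decomposition of {0,1}^n (possibly with empty chains).
chains : (n : ℕ) → List (List (Cube n))
chains zero    = ([] ∷ []) ∷ []
chains (suc n) = splitChains (chains n)

splitChains-All : ∀ {n} {P : List (Cube n) → Set} {Q : List (Cube (suc n)) → Set} →
  (∀ Ch → P Ch → Q (grow Ch)) → (∀ Ch → P Ch → Q (shrink Ch)) →
  ∀ {Chs} → All P Chs → All Q (splitChains Chs)
splitChains-All onGrow onShrink []                = []
splitChains-All onGrow onShrink {Ch ∷ _} (p ∷ ps) =
  onGrow Ch p ∷ onShrink Ch p ∷ splitChains-All onGrow onShrink ps

∑-chains : ∀ n (f : Cube n → ℕ) → ∑ (∑ f) (chains n) ≡ ∑ f (cube n)
∑-chains zero    f = +-identityʳ _
∑-chains (suc n) f = begin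
  ∑ (∑ f) (splitChains (chains n))          ≡⟨ ∑-split (chains n) ⟩
  ∑ (∑ f₀) (chains n) + ∑ (∑ f₁) (chains n) ≡⟨ cong₂ _+_ (∑-chains n f₀) (∑-chains n f₁) ⟩
  ∑ f₀ (cube n) + ∑ f₁ (cube n)              ≡⟨ sym (∑-cube f) ⟩
  ∑ f (cube (suc n)) ∎
  where
  open ≡-Reasoning
  f₀ f₁ : Cube n → ℕ
  f₀ x = f (false ∷ x)
  f₁ x = f (true ∷ x)
  -- the two chains made from Ch contain the points 0x and 1x for x ∈ Ch
  ∑-step : ∀ Ch → ∑ f (grow Ch) + ∑ f (shrink Ch) ≡ ∑ f₀ Ch + ∑ f₁ Ch
  ∑-step []       = refl
  ∑-step (x ∷ xs) = begin
    (f₀ x + (f₁ x + ∑ f (map (true ∷_) xs))) + ∑ f (map (false ∷_) xs)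
      ≡⟨ cong₂ (λ a b → (f₀ x + (f₁ x + a)) + b) (∑-map f (true ∷_) xs) (∑-map f (false ∷_) xs) ⟩
    (f₀ x + (f₁ x + ∑ f₁ xs)) + ∑ f₀ xs
      ≡⟨ +-assoc (f₀ x) (f₁ x + ∑ f₁ xs) (∑ f₀ xs) ⟩
    f₀ x + ((f₁ x + ∑ f₁ xs) + ∑ f₀ xs)
      ≡⟨ cong (f₀ x +_) (+-comm (f₁ x + ∑ f₁ xs) (∑ f₀ xs)) ⟩
    f₀ x + (∑ f₀ xs + (f₁ x + ∑ f₁ xs))
      ≡⟨ sym (+-assoc (f₀ x) (∑ f₀ xs) (f₁ x + ∑ f₁ xs)) ⟩
    (f₀ x + ∑ f₀ xs) + (f₁ x + ∑ f₁ xs) ∎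
  ∑-split : ∀ Chs → ∑ (∑ f) (splitChains Chs) ≡ ∑ (∑ f₀) Chs + ∑ (∑ f₁) Chs
  ∑-split []         = refl
  ∑-split (Ch ∷ Chs) = begin
    ∑ f (grow Ch) + (∑ f (shrink Ch) + ∑ (∑ f) (splitChains Chs))
      ≡⟨ sym (+-assoc (∑ f (grow Ch)) (∑ f (shrink Ch)) _) ⟩
    (∑ f (grow Ch) + ∑ f (shrink Ch)) + ∑ (∑ f) (splitChains Chs)
      ≡⟨ cong₂ _+_ (∑-step Ch) (∑-split Chs) ⟩
    (∑ f₀ Ch + ∑ f₁ Ch) + (∑ (∑ f₀) Chs + ∑ (∑ f₁) Chs)
      ≡⟨ interchange (∑ f₀ Ch) (∑ f₁ Ch) (∑ (∑ f₀) Chs) (∑ (∑ f₁) Chs) ⟩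
    ∑ (∑ f₀) (Ch ∷ Chs) + ∑ (∑ f₁) (Ch ∷ Chs) ∎

_≺_ : ∀ {n} → Cube n → Cube n → Set
x ≺ y = x ≼ y × ¬ (x ≡ y)

chains-increasing : ∀ n → All (AllPairs _≺_) (chains n)
chains-increasing zero    = ([] ∷ []) ∷ []
chains-increasing (suc n) = splitChains-All grow-increasing shrink-increasing (chains-increasing n)
  where
  prefix : ∀ {n} b {x y : Cube n} → x ≺ y → (b ∷ x) ≺ (b ∷ y)
  prefix b (x≼y , x≢y) = (b≤b ∷ x≼y) , λ { refl → x≢y refl }
  prefix-all : ∀ {n} b {xs : List (Cube n)} → AllPairs _≺_ xs → AllPairs _≺_ (map (b ∷_) xs)
  prefix-all b increasing = AllPairsₚ.map⁺ (AllPairs.map (prefix b) increasing)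
  grow-increasing : ∀ {n} (Ch : List (Cube n)) → AllPairs _≺_ Ch → AllPairs _≺_ (grow Ch)
  grow-increasing []       _                        = []
  grow-increasing (x ∷ xs) increasing@(x≺xs ∷ _) =
    map⁺ (All.map (λ x≼y → (f≤t ∷ x≼y) , λ ()) (≼-refl x ∷ All.map proj₁ x≺xs))
    ∷ prefix-all true increasing
  shrink-increasing : ∀ {n} (Ch : List (Cube n)) → AllPairs _≺_ Ch → AllPairs _≺_ (shrink Ch)
  shrink-increasing []       _                  = []
  shrink-increasing (x ∷ xs) (_ ∷ increasing) = prefix-all false increasing

Run : ∀ {n} → ℕ → List (Cube n) → Set
Run i []       = ⊤
Run i (x ∷ xs) = (wt x ≡ i) × Run (suc i) xs

-- A symmetric chain of {0,1}^n: it runs through the levels i, i+1, …, n-i.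
Symmetric : ∀ n → List (Cube n) → Set
Symmetric n []       = ⊤
Symmetric n (x ∷ xs) = Σ ℕ λ i → Run i (x ∷ xs) × (i + i + length xs ≡ n)

chains-symmetric : ∀ n → All (Symmetric n) (chains n)
chains-symmetric zero    = (0 , (refl , tt) , refl) ∷ []
chains-symmetric (suc n) = splitChains-All grow-symmetric shrink-symmetric (chains-symmetric n)
  where
  prefix-run : ∀ {n} b i (xs : List (Cube n)) → Run i xs → Run (ι b + i) (map (b ∷_) xs)
  prefix-run b     i []       _          = tt
  prefix-run false i (x ∷ xs) (w , run) = w , prefix-run false (suc i) xs run
  prefix-run true  i (x ∷ xs) (w , run) = cong suc w , prefix-run true (suc i) xs run
  grow-symmetric : ∀ {n} (Ch : List (Cube n)) → Symmetric n Ch → Symmetric (suc n) (grow Ch)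
  grow-symmetric []       _                      = tt
  grow-symmetric (x ∷ xs) (i , (w , run) , len) =
    i , (w , (cong suc w , prefix-run true (suc i) xs run)) , (begin
      i + i + suc (length (map (true ∷_) xs)) ≡⟨ cong (λ l → i + i + suc l) (length-map (true ∷_) xs) ⟩
      i + i + suc (length xs)                 ≡⟨ +-suc (i + i) (length xs) ⟩
      suc (i + i + length xs)                 ≡⟨ cong suc len ⟩
      suc _ ∎)
    where open ≡-Reasoning
  shrink-symmetric : ∀ {n} (Ch : List (Cube n)) → Symmetric n Ch → Symmetric (suc n) (shrink Ch)
  shrink-symmetric []           _                                = tt
  shrink-symmetric (x ∷ [])     _                                = tt
  shrink-symmetric (x ∷ y ∷ ys) (i , (_ , (w , run)) , len) =
    suc i , (w , prefix-run false (suc (suc i)) ys run) , (begin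
      suc i + suc i + length (map (false ∷_) ys) ≡⟨ cong (suc i + suc i +_) (length-map (false ∷_) ys) ⟩
      suc (i + suc i + length ys)                ≡⟨ cong (λ m → suc (m + length ys)) (+-suc i i) ⟩
      suc (suc (i + i) + length ys)              ≡⟨ cong suc (sym (+-suc (i + i) (length ys))) ⟩
      suc (i + i + suc (length ys))              ≡⟨ cong suc len ⟩
      suc _ ∎)
    where open ≡-Reasoning

Below Outside : ∀ {n} → Cube n → List (Cube n) → Set
Below   g xs = All (λ x → (x ≤ᶜ g) ≡ true) xs
Outside g xs = All (λ x → (x ≤ᶜ g) ≡ false) xs

TailOutside : ∀ {n} → Cube n → List (Cube n) → Set
TailOutside g []       = ⊤
TailOutside g (x ∷ xs) = Outside g xs

Shape : ∀ {n} → Cube n → List (Cube n) → Set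
Shape g Ch = Below g Ch ⊎ TailOutside g Ch

-- Relative to g = γ n s every chain has this shape: below γ (n+1) s = 0(γ n s)
-- the grown chain keeps only its new first point 0x₁, and the shrunk chain
-- 0x₂ ≺ … inherits the shape of x₁ ≺ x₂ ≺ … .
chains-shape : ∀ n s → s ≤ n → All (Shape (γ n s)) (chains n)
chains-shape zero    _ z≤n = inj₁ (refl ∷ []) ∷ []
chains-shape (suc n) s s≤ with m≤n⇒m<n∨m≡n s≤
... | inj₂ refl rewrite γ-top (suc n) =
  All.universal (λ Ch → inj₁ (All.universal ≤ᶜ-top Ch)) (chains (suc n))
... | inj₁ (s≤s s≤n) rewrite γ-suc n s s≤n =
  splitChains-All (grow-shape (γ n s)) (shrink-shape (γ n s)) (chains-shape n s s≤n)
  where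
  grow-shape : ∀ {n} (g : Cube n) Ch → Shape g Ch → Shape (false ∷ g) (grow Ch)
  grow-shape g []       _ = inj₁ []
  grow-shape g (x ∷ xs) _ = inj₂ (map⁺ (All.universal (λ _ → refl) (x ∷ xs)))
  shrink-shape : ∀ {n} (g : Cube n) Ch → Shape g Ch → Shape (false ∷ g) (shrink Ch)
  shrink-shape g []       _                  = inj₁ []
  shrink-shape g (x ∷ xs) (inj₁ (_ ∷ below)) = inj₁ (map⁺ below)
  shrink-shape g (x ∷ xs) (inj₂ outside)     = inj₂ (drop-head (map⁺ outside))
    where
    drop-head : ∀ {ys} → Outside (false ∷ g) ys → TailOutside (false ∷ g) ys
    drop-head []      = tt
    drop-head (_ ∷ p) = p

≡ᵇ-refl : ∀ m → (m ≡ᵇ m) ≡ true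
≡ᵇ-refl zero    = refl
≡ᵇ-refl (suc m) = ≡ᵇ-refl m

run-hits : ∀ {n} a (Ch : List (Cube n)) → Run a Ch →
  ∀ d → d < length Ch → 1 ≤ ∑ (λ x → level (a + d) (wt x)) Ch
run-hits a (x ∷ xs) (w , run) zero    _ rewrite +-identityʳ a | w | ≡ᵇ-refl a = s≤s z≤n
run-hits a (x ∷ xs) (w , run) (suc d) (s≤s d<l) rewrite +-suc a d =
  ≤-trans (run-hits (suc a) xs run d d<l) (m≤n+m _ _)

module _ {n : ℕ} (k : ℕ) (Ch : List (Cube n)) where
  private
    ∑-middle : ∑ (λ x → level k (wt x)) Ch + ∑ (λ x → level (suc k) (wt x)) Ch
             ≡ ∑ (λ x → middle k (wt x)) Ch
    ∑-middle = sym (∑-+ (λ x → level k (wt x)) (λ x → level (suc k) (wt x)) Ch)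

  hit-low : 1 ≤ ∑ (λ x → level k (wt x)) Ch → 1 ≤ ∑ (λ x → middle k (wt x)) Ch
  hit-low p = ≤-trans p (≤-trans (m≤m+n _ _) (≤-reflexive ∑-middle))

  hit-high : 1 ≤ ∑ (λ x → level (suc k) (wt x)) Ch → 1 ≤ ∑ (λ x → middle k (wt x)) Ch
  hit-high p = ≤-trans p (≤-trans (m≤n+m _ _) (≤-reflexive ∑-middle))

  hit-both : 1 ≤ ∑ (λ x → level k (wt x)) Ch → 1 ≤ ∑ (λ x → level (suc k) (wt x)) Ch →
    2 ≤ ∑ (λ x → middle k (wt x)) Ch
  hit-both p q = ≤-trans (+-mono-≤ p q) (≤-reflexive ∑-middle)

-- A run of length l+1 from level i contains min(2, l+1) middle points for
-- k = i + ⌊l/2⌋ (the two levels at the centre of the run).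
run-middle : ∀ {n} i (x : Cube n) xs → Run i (x ∷ xs) →
  2 ⊓ suc (length xs) ≤ ∑ (λ y → middle (i + ⌊ length xs /2⌋) (wt y)) (x ∷ xs)
run-middle i x []       run = hit-low (i + 0) (x ∷ []) (run-hits i (x ∷ []) run 0 (s≤s z≤n))
run-middle i x (y ∷ ys) run = hit-both (i + h) (x ∷ y ∷ ys)
  (run-hits i (x ∷ y ∷ ys) run h (s≤s (⌊n/2⌋≤n (suc (length ys)))))
  (subst (λ j → 1 ≤ ∑ (λ z → level j (wt z)) (x ∷ y ∷ ys)) (+-suc i h)
    (run-hits i (x ∷ y ∷ ys) run (suc h) (s≤s (⌊n/2⌋<n (length ys)))))
  where h = ⌊ suc (length ys) /2⌋

run-tail-middle : ∀ {n} i (xs : List (Cube n)) → Run (suc i) xs →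
  2 ⊓ length xs ≤ ∑ (λ y → middle (i + ⌊ length xs /2⌋) (wt y)) xs
run-tail-middle i []           run = z≤n
run-tail-middle i (x ∷ [])     run = hit-high (i + 0) (x ∷ []) (run-hits (suc i) (x ∷ []) run 0 (s≤s z≤n))
run-tail-middle i (x ∷ y ∷ ys) run = hit-both (i + suc h) (x ∷ y ∷ ys)
  (subst (λ j → 1 ≤ ∑ (λ z → level j (wt z)) (x ∷ y ∷ ys)) (sym (+-suc i h))
    (run-hits (suc i) (x ∷ y ∷ ys) run h (s≤s (m≤n⇒m≤1+n (⌊n/2⌋≤n (length ys))))))
  (run-hits (suc i) (x ∷ y ∷ ys) run (suc h) (s≤s (s≤s (⌊n/2⌋≤n (length ys)))))
  where h = ⌊ length ys /2⌋

chain-centre : ∀ {n} i l → i + i + l ≡ n → ⌊ n /2⌋ ≡ i + ⌊ l /2⌋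
chain-centre i l len = trans (cong ⌊_/2⌋ (sym len)) (half i)
  where
  half : ∀ i → ⌊ i + i + l /2⌋ ≡ i + ⌊ l /2⌋
  half zero    = refl
  half (suc i) rewrite +-suc i i = cong suc (half i)

notBelow : ∀ {n} → Cube n → Cube n → ℕ
notBelow g x = ι (not (x ≤ᶜ g))

module _ {n : ℕ} (g : Cube n) where
  ∑-notBelow-below : ∀ {xs} → Below g xs → ∑ (notBelow g) xs ≡ 0
  ∑-notBelow-below []      = refl
  ∑-notBelow-below (e ∷ p) = cong₂ _+_ (cong (λ b → ι (not b)) e) (∑-notBelow-below p)

  ∑-notBelow-outside : ∀ {xs} → Outside g xs → ∑ (notBelow g) xs ≡ length xs
  ∑-notBelow-outside []      = refl
  ∑-notBelow-outside (e ∷ p) = cong₂ _+_ (cong (λ b → ι (not b)) e) (∑-notBelow-outside p)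

module _ {n : ℕ} (k : ℕ) (g : Cube n) where
  ∑-belowMiddle-below : ∀ {xs} → Below g xs → ∑ (belowMiddle k g) xs ≡ ∑ (λ x → middle k (wt x)) xs
  ∑-belowMiddle-below []              = refl
  ∑-belowMiddle-below {x ∷ _} (e ∷ p) =
    cong₂ _+_ (cong (λ b → if b then middle k (wt x) else 0) e) (∑-belowMiddle-below p)

  ∑-belowMiddle-outside : ∀ {xs} → Outside g xs → ∑ (belowMiddle k g) xs ≡ 0
  ∑-belowMiddle-outside []              = refl
  ∑-belowMiddle-outside {x ∷ _} (e ∷ p) =
    cong₂ _+_ (cong (λ b → if b then middle k (wt x) else 0) e) (∑-belowMiddle-outside p)

middle-budget : ∀ {n} (g : Cube n) (Ch : List (Cube n)) → Symmetric n Ch → Shape g Ch →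
  2 ⊓ ∑ (notBelow g) Ch + ∑ (belowMiddle ⌊ n /2⌋ g) Ch ≤ ∑ (λ x → middle ⌊ n /2⌋ (wt x)) Ch
middle-budget {n} g Ch _ (inj₁ below) = ≤-reflexive (begin
  2 ⊓ ∑ (notBelow g) Ch + ∑ (belowMiddle ⌊ n /2⌋ g) Ch
    ≡⟨ cong₂ (λ a b → 2 ⊓ a + b) (∑-notBelow-below g below) (∑-belowMiddle-below ⌊ n /2⌋ g below) ⟩
  ∑ (λ x → middle ⌊ n /2⌋ (wt x)) Ch ∎)
  where open ≡-Reasoning
middle-budget g []       _                   (inj₂ _)       = z≤n
middle-budget {n} g (x ∷ xs) (i , run , len) (inj₂ outside) with x ≤ᶜ g
... | true  = begin
  2 ⊓ ∑ (notBelow g) xs + (middle k (wt x) + ∑ (belowMiddle k g) xs)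
    ≡⟨ cong₂ (λ a b → 2 ⊓ a + (middle k (wt x) + b))
         (∑-notBelow-outside g outside) (∑-belowMiddle-outside k g outside) ⟩
  2 ⊓ length xs + (middle k (wt x) + 0)
    ≡⟨ trans (cong (2 ⊓ length xs +_) (+-identityʳ _)) (+-comm (2 ⊓ length xs) _) ⟩
  middle k (wt x) + 2 ⊓ length xs
    ≤⟨ +-monoʳ-≤ (middle k (wt x))
         (subst (λ j → 2 ⊓ length xs ≤ ∑ (λ y → middle j (wt y)) xs) (sym centre)
           (run-tail-middle i xs (proj₂ run))) ⟩
  middle k (wt x) + ∑ (λ y → middle k (wt y)) xs ∎
  where
  open ≤-Reasoning
  k = ⌊ n /2⌋
  centre : k ≡ i + ⌊ length xs /2⌋
  centre = chain-centre i (length xs) len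
... | false = begin
  2 ⊓ suc (∑ (notBelow g) xs) + ∑ (belowMiddle k g) xs
    ≡⟨ cong₂ (λ a b → 2 ⊓ suc a + b)
         (∑-notBelow-outside g outside) (∑-belowMiddle-outside k g outside) ⟩
  2 ⊓ suc (length xs) + 0
    ≡⟨ +-identityʳ _ ⟩
  2 ⊓ suc (length xs)
    ≤⟨ subst (λ j → 2 ⊓ suc (length xs) ≤ ∑ (λ y → middle j (wt y)) (x ∷ xs)) (sym centre)
         (run-middle i x xs run) ⟩
  ∑ (λ y → middle k (wt y)) (x ∷ xs) ∎
  where
  open ≤-Reasoning
  k = ⌊ n /2⌋
  centre : k ≡ i + ⌊ length xs /2⌋
  centre = chain-centre i (length xs) len

module AtMostTwo {A : Set} (_⊏_ : A → A → Set) (q : A → Bool) (L U : A → Set)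
  (ordered : ∀ a b → q a ≡ true → q b ≡ true → a ⊏ b → L a × U b)
  (exclusive : ∀ a → L a → U a → ⊥) where

  private
    count : List A → ℕ
    count = ∑ (λ x → ι (q x))

    none-after-upper : ∀ y xs → q y ≡ true → U y → All (y ⊏_) xs → count xs ≡ 0
    none-after-upper y []       qy u []       = refl
    none-after-upper y (z ∷ zs) qy u (y⊏z ∷ rs) with q z in qz
    ... | true  = ⊥-elim (exclusive y (proj₁ (ordered y z qy qz y⊏z)) u)
    ... | false = none-after-upper y zs qy u rs

    one-after : ∀ y xs → q y ≡ true → All (y ⊏_) xs → AllPairs _⊏_ xs → count xs ≤ 1
    one-after y []       qy []         []           = z≤n
    one-after y (z ∷ zs) qy (y⊏z ∷ rs) (z⊏zs ∷ inc) with q z in qz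
    ... | true  rewrite none-after-upper z zs qz (proj₂ (ordered y z qy qz y⊏z)) z⊏zs = ≤-refl
    ... | false = one-after y zs qy rs inc

  at-most-two : ∀ xs → AllPairs _⊏_ xs → count xs ≤ 2
  at-most-two []       []           = z≤n
  at-most-two (y ∷ ys) (y⊏ys ∷ inc) with q y in qy
  ... | true  = s≤s (one-after y ys qy y⊏ys inc)
  ... | false = at-most-two ys inc

module Split {n : ℕ} (g : Cube n) (T′ T″ : List (Cube n))
  (A′ : IsAntichain T′) (A″ : IsAntichain T″) (g∈T′ : g ∈ T′)
  (cross : ∀ (α′ α″ : Cube n) → α′ ∈ T′ → α″ ∈ T″ → ¬ (α″ ≼ α′)) where

  k : ℕ
  k = ⌊ n /2⌋

  other : Cube n → Bool
  other x = not (x ≡ᶜ g) ∧ ((x ∈ᶜ T′) ∨ (x ∈ᶜ T″))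

  disjoint : ∀ x → x ∈ T′ → x ∈ T″ → ⊥
  disjoint x x∈T′ x∈T″ = cross x x x∈T′ x∈T″ (≼-refl x)

  other-≢ : ∀ x → other x ≡ true → ¬ x ≡ g
  other-≢ x o refl with x ≡ᶜ x | ≡ᶜ-refl x
  ... | .true | refl with () ← o

  other-∈ : ∀ x → other x ≡ true → x ∈ T′ ⊎ x ∈ T″
  other-∈ x o with x ≡ᶜ g | x ∈ᶜ T′ in m′ | x ∈ᶜ T″ in m″
  ... | false | true  | _    = inj₁ (∈ᶜ-sound x T′ m′)
  ... | false | false | true = inj₂ (∈ᶜ-sound x T″ m″)

  other-ordered : ∀ a b → other a ≡ true → other b ≡ true → a ≺ b → a ∈ T′ × b ∈ T″
  other-ordered a b oa ob (a≼b , a≢b) with other-∈ a oa | other-∈ b ob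
  ... | inj₁ a∈T′ | inj₁ b∈T′ = ⊥-elim (a≢b (proj₂ A′ a b a∈T′ b∈T′ a≼b))
  ... | inj₂ a∈T″ | inj₂ b∈T″ = ⊥-elim (a≢b (proj₂ A″ a b a∈T″ b∈T″ a≼b))
  ... | inj₂ a∈T″ | inj₁ b∈T′ = ⊥-elim (cross b a b∈T′ a∈T″ a≼b)
  ... | inj₁ a∈T′ | inj₂ b∈T″ = a∈T′ , b∈T″

  open AtMostTwo _≺_ other (_∈ T′) (_∈ T″) other-ordered disjoint using (at-most-two)

  -- every point of T′ ∪ T″ is g or another point (g ∉ T″ by disjointness)
  membership-split : ∀ x → ι (x ∈ᶜ T′) + ι (x ∈ᶜ T″) ≤ ι (x ≡ᶜ g) + ι (other x)
  membership-split x with x ∈ᶜ T′ in m′ | x ∈ᶜ T″ in m″ | x ≡ᶜ g in e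
  ... | true  | true  | _     = ⊥-elim (disjoint x (∈ᶜ-sound x T′ m′) (∈ᶜ-sound x T″ m″))
  ... | false | true  | true  with refl ← ≡ᶜ-sound x g e = ⊥-elim (disjoint g g∈T′ (∈ᶜ-sound g T″ m″))
  ... | true  | false | true  = ≤-refl
  ... | true  | false | false = ≤-refl
  ... | false | true  | false = ≤-refl
  ... | false | false | _     = z≤n

  -- the other points lie outside ↓g: below g, T′ has only g and T″ nothing
  other-outside : ∀ x → ι (other x) ≤ notBelow g x
  other-outside x with x ≤ᶜ g in below | other x in o
  ... | false | true  = ≤-refl
  ... | false | false = z≤n
  ... | true  | false = z≤n
  ... | true  | true  with other-∈ x o
  ...   | inj₁ x∈T′ = ⊥-elim (other-≢ x o (proj₂ A′ x g x∈T′ g∈T′ (≤ᶜ-sound x g below)))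
  ...   | inj₂ x∈T″ = ⊥-elim (cross g x g∈T′ x∈T″ (≤ᶜ-sound x g below))

  F H : Cube n → ℕ
  F x = ι (x ∈ᶜ T′) + ι (x ∈ᶜ T″) + belowMiddle k g x
  H x = ι (x ≡ᶜ g) + middle k (wt x)

  chain-bound : ∀ {Ch} → AllPairs _≺_ Ch → Symmetric n Ch → Shape g Ch → ∑ F Ch ≤ ∑ H Ch
  chain-bound {Ch} increasing symmetric shape = begin
    ∑ F Ch
      ≡⟨ ∑-+ (λ x → ι (x ∈ᶜ T′) + ι (x ∈ᶜ T″)) (belowMiddle k g) Ch ⟩
    ∑ (λ x → ι (x ∈ᶜ T′) + ι (x ∈ᶜ T″)) Ch + ∑ (belowMiddle k g) Ch
      ≤⟨ +-monoˡ-≤ (∑ (belowMiddle k g) Ch) (∑-mono (All.universal membership-split Ch)) ⟩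
    ∑ (λ x → ι (x ≡ᶜ g) + ι (other x)) Ch + ∑ (belowMiddle k g) Ch
      ≡⟨ cong (_+ ∑ (belowMiddle k g) Ch) (∑-+ (λ x → ι (x ≡ᶜ g)) (λ x → ι (other x)) Ch) ⟩
    (∑ (λ x → ι (x ≡ᶜ g)) Ch + ∑ (λ x → ι (other x)) Ch) + ∑ (belowMiddle k g) Ch
      ≡⟨ +-assoc (∑ (λ x → ι (x ≡ᶜ g)) Ch) _ _ ⟩
    ∑ (λ x → ι (x ≡ᶜ g)) Ch + (∑ (λ x → ι (other x)) Ch + ∑ (belowMiddle k g) Ch)
      ≤⟨ +-monoʳ-≤ (∑ (λ x → ι (x ≡ᶜ g)) Ch) (+-monoˡ-≤ (∑ (belowMiddle k g) Ch)
           (⊓-glb (at-most-two Ch increasing) (∑-mono (All.universal other-outside Ch)))) ⟩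
    ∑ (λ x → ι (x ≡ᶜ g)) Ch + (2 ⊓ ∑ (notBelow g) Ch + ∑ (belowMiddle k g) Ch)
      ≤⟨ +-monoʳ-≤ (∑ (λ x → ι (x ≡ᶜ g)) Ch) (middle-budget g Ch symmetric shape) ⟩
    ∑ (λ x → ι (x ≡ᶜ g)) Ch + ∑ (λ x → middle k (wt x)) Ch
      ≡⟨ sym (∑-+ (λ x → ι (x ≡ᶜ g)) (λ x → middle k (wt x)) Ch) ⟩
    ∑ H Ch ∎
    where open ≤-Reasoning

  split-bound : All (Shape g) (chains n) →
    length T′ + length T″ + ∑ (belowMiddle k g) (cube n) ≤ 1 + ∑ (λ x → middle k (wt x)) (cube n)
  split-bound shapes = begin
    length T′ + length T″ + ∑ (belowMiddle k g) (cube n)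
      ≤⟨ +-monoˡ-≤ (∑ (belowMiddle k g) (cube n)) (+-mono-≤ (unique-count T′ (proj₁ A′)) (unique-count T″ (proj₁ A″))) ⟩
    ∑ (λ x → ι (x ∈ᶜ T′)) (cube n) + ∑ (λ x → ι (x ∈ᶜ T″)) (cube n) + ∑ (belowMiddle k g) (cube n)
      ≡⟨ sym (trans (∑-+ (λ x → ι (x ∈ᶜ T′) + ι (x ∈ᶜ T″)) (belowMiddle k g) (cube n))
                    (cong (_+ ∑ (belowMiddle k g) (cube n)) (∑-+ (λ x → ι (x ∈ᶜ T′)) (λ x → ι (x ∈ᶜ T″)) (cube n)))) ⟩
    ∑ F (cube n)
      ≡⟨ sym (∑-chains n F) ⟩
    ∑ (∑ F) (chains n)
      ≤⟨ ∑-mono (All.zipWith (λ (increasing , symmetric , shape) → chain-bound increasing symmetric shape)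
                  (chains-increasing n , All.zip (chains-symmetric n , shapes))) ⟩
    ∑ (∑ H) (chains n)
      ≡⟨ ∑-chains n H ⟩
    ∑ H (cube n)
      ≡⟨ ∑-+ (λ x → ι (x ≡ᶜ g)) (λ x → middle k (wt x)) (cube n) ⟩
    ∑ (λ x → ι (x ≡ᶜ g)) (cube n) + ∑ (λ x → middle k (wt x)) (cube n)
      ≡⟨ cong (_+ ∑ (λ x → middle k (wt x)) (cube n)) (point-count n g) ⟩
    1 + ∑ (λ x → middle k (wt x)) (cube n) ∎
    where open ≤-Reasoning

upper-middle : ∀ n → n / 2 + 1 ≡ suc ⌊ n /2⌋
upper-middle n = trans (+-comm (n / 2) 1) (cong suc (half n))
  where
  half : ∀ n → n / 2 ≡ ⌊ n /2⌋
  half zero          = refl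
  half (suc zero)    = refl
  half (suc (suc n)) = trans (m/n≡1+[m∸n]/n {suc (suc n)} {2} (s≤s (s≤s z≤n))) (cong suc (half n))

theorem1 : (n s : ℕ) → 1 ≤ n → n < 2 * s → s ≤ n →
    (T′ T″ : List (Cube n)) → IsAntichain T′ → IsAntichain T″ →
    γ n s ∈ T′ →
    (∀ (α′ α″ : Cube n) → α′ ∈ T′ → α″ ∈ T″ → ¬ (α″ ≼ α′)) →
    length T′ + length T″ + suc s C (n / 2 + 1)
      ≤ 1 + suc n C (n / 2 + 1)
theorem1 n s _ _ s≤n T′ T″ A′ A″ γ∈T′ cross = begin
  length T′ + length T″ + suc s C (n / 2 + 1)
    ≡⟨ cong (λ j → length T′ + length T″ + suc s C j) (upper-middle n) ⟩
  length T′ + length T″ + suc s C suc k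
    ≡⟨ cong (length T′ + length T″ +_) (sym (below-middle-count n s s≤n k)) ⟩
  length T′ + length T″ + ∑ (belowMiddle k (γ n s)) (cube n)
    ≤⟨ Split.split-bound (γ n s) T′ T″ A′ A″ γ∈T′ cross (chains-shape n s s≤n) ⟩
  1 + ∑ (λ x → middle k (wt x)) (cube n)
    ≡⟨ cong (1 +_) (middle-count n k) ⟩
  1 + suc n C suc k
    ≡⟨ cong (λ j → 1 + suc n C j) (sym (upper-middle n)) ⟩
  1 + suc n C (n / 2 + 1) ∎
  where
  open ≤-Reasoning
  k = ⌊ n /2⌋
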